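{- Let a graph $G$ be factored into regular graphs $H$ and $K$. Then $G$ is regular.
   Context: All graphs are finite and simple. A graph $G$ is factored into graphs $H$ and $K$ (all on $n$ vertices) if there exist adjacency matrices $A,B,C$ of $G,H,K$ respectively (symmetric $n\times n$ $(0,1)$-matrices with zero diagonal, for some vertex orderings) with $A=BC$; the three graphs are then regarded as having the common vertex set $\{1,\dots,n\}$. -}

module Defs where

open import Data.Nat using (ℕ; zero; suc; _+_; _*_)
open import Data.Bool using (Bool; true; false; if_then_else_)
open import Data.Fin using (Fin; zero; suc)
open import Data.Product using (Σ; ∃; _×_; _,_)
open import Function.Bundles using (_↔_; Inverse)
open import Relation.Binary.PropositionalEquality using (_≡_)

∑ : (n : ℕ) → (Fin n → ℕ) → ℕ
∑ zero    f = 0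
∑ (suc n) f = f zero + ∑ n (λ i → f (suc i))

Matrix : ℕ → Set
Matrix n = Fin n → Fin n → ℕ

_·_ : ∀ {n} → Matrix n → Matrix n → Matrix n
(B · C) i j = ∑ _ (λ k → B i k * C k j)

record Graph (n : ℕ) : Set where
  field
    adj   : Fin n → Fin n → Bool
    sym   : ∀ u v → adj u v ≡ adj v u
    irrefl : ∀ v → adj v v ≡ false
open Graph public

b2n : Bool → ℕ
b2n true  = 1
b2n false = 0

adjMatrix : ∀ {n} → Graph n → (Fin n ↔ Fin n) → Matrix n
adjMatrix G σ i j = b2n (adj G (Inverse.to σ i) (Inverse.to σ j))

IsAdjacencyMatrixOf : ∀ {n} → Matrix n → Graph n → Set
IsAdjacencyMatrixOf {n} A G = Σ (Fin n ↔ Fin n) λ σ → ∀ i j → A i j ≡ adjMatrix G σ i j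

FactoredInto : ∀ {n} → Graph n → Graph n → Graph n → Set
FactoredInto {n} G H K =
  Σ (Matrix n) λ A → Σ (Matrix n) λ B → Σ (Matrix n) λ C →
    IsAdjacencyMatrixOf A G × IsAdjacencyMatrixOf B H × IsAdjacencyMatrixOf C K ×
    (∀ i j → A i j ≡ (B · C) i j)

degree : ∀ {n} → Graph n → Fin n → ℕ
degree {n} G v = ∑ n (λ u → b2n (adj G v u))

Regular : ∀ {n} → Graph n → Set
Regular {n} G = ∃ λ k → ∀ v → degree G v ≡ k

{-# OPTIONS --safe #-}
-- The degree of vertex v is the row sum of the adjacency matrix at
-- v's row. If every row of C sums to c, then every row of B C sums to c times
-- the corresponding row sum of B; so if H is b-regular and K is c-regular, every
-- row of A = B C sums to b c, i.e. G is (b c)-regular.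
module Submission where

open import Defs hiding (sym)
open import Data.Nat using (ℕ; zero; suc; _+_; _*_)
open import Data.Nat.Properties using (+-*-semiring)
open import Data.Fin using (Fin; zero; suc)
open import Data.Fin.Permutation using (inverseʳ)
open import Data.Product using (proj₁; proj₂; _,_)
open import Function.Bundles using (Inverse)
open import Relation.Binary.PropositionalEquality
  using (_≡_; refl; sym; trans; cong; module ≡-Reasoning)
open import Algebra.Properties.Semiring.Sum +-*-semiring
  using (sum; sum-cong-≗; ∑-comm; ∑-permute; *-distribˡ-sum; *-distribʳ-sum)

∑≡sum : ∀ n (f : Fin n → ℕ) → ∑ n f ≡ sum f
∑≡sum zero    f = refl
∑≡sum (suc n) f = cong (f zero +_) (∑≡sum n (λ i → f (suc i)))

module _ {n : ℕ} where

  rowSum : Matrix n → Fin n → ℕ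
  rowSum M i = sum (M i)

  rowSum-· : ∀ {c} (B C : Matrix n) → (∀ k → rowSum C k ≡ c) →
             ∀ i → rowSum (B · C) i ≡ rowSum B i * c
  rowSum-· {c} B C rowC≡c i = begin
    sum (λ j → ∑ n (λ k → B i k * C k j))  ≡⟨ sum-cong-≗ {n} (λ j → ∑≡sum n (λ k → B i k * C k j)) ⟩
    sum (λ j → sum (λ k → B i k * C k j))  ≡⟨ ∑-comm (λ j k → B i k * C k j) ⟩
    sum (λ k → sum (λ j → B i k * C k j))  ≡⟨ sum-cong-≗ {n} (λ k → sym (*-distribˡ-sum (B i k) (C k))) ⟩
    sum (λ k → B i k * sum (C k))          ≡⟨ sum-cong-≗ {n} (λ k → cong (B i k *_) (rowC≡c k)) ⟩
    sum (λ k → B i k * c)                  ≡⟨ *-distribʳ-sum c (B i) ⟨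
    sum (B i) * c                          ∎
    where open ≡-Reasoning

  module _ (A : Matrix n) (G : Graph n) (adjA : IsAdjacencyMatrixOf A G) where

    private
      σ = proj₁ adjA
      open Inverse σ using (to; from)

    rowSum-adjacency : ∀ i → rowSum A i ≡ degree G (to i)
    rowSum-adjacency i = begin
      sum (A i)                                  ≡⟨ sum-cong-≗ {n} (proj₂ adjA i) ⟩
      sum (λ j → b2n (adj G (to i) (to j)))      ≡⟨ ∑-permute (λ u → b2n (adj G (to i) u)) σ ⟨
      sum (λ u → b2n (adj G (to i) u))           ≡⟨ ∑≡sum n _ ⟨
      degree G (to i)                            ∎
      where open ≡-Reasoning

    regular⇒rowSum≡ : ∀ {d} → (∀ v → degree G v ≡ d) → ∀ i → rowSum A i ≡ d
    regular⇒rowSum≡ degree≡d i = trans (rowSum-adjacency i) (degree≡d (to i))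

    rowSum≡⇒regular : ∀ {d} → (∀ i → rowSum A i ≡ d) → ∀ v → degree G v ≡ d
    rowSum≡⇒regular {d} rowA≡d v = begin
      degree G v                ≡⟨ cong (degree G) (inverseʳ σ) ⟨
      degree G (to (from v))    ≡⟨ rowSum-adjacency (from v) ⟨
      rowSum A (from v)         ≡⟨ rowA≡d (from v) ⟩
      d                         ∎
      where open ≡-Reasoning

corollary4p1 : (n : ℕ) (G H K : Graph n) →
    FactoredInto G H K → Regular H → Regular K → Regular G
corollary4p1 n G H K (A , B , C , adjA , adjB , adjC , A≡BC) (b , regH) (c , regK) =
  b * c , rowSum≡⇒regular A G adjA rowA≡bc
  where
  rowA≡bc : ∀ i → rowSum A i ≡ b * c
  rowA≡bc i = begin
    rowSum A i        ≡⟨ sum-cong-≗ {n} (A≡BC i) ⟩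
    rowSum (B · C) i  ≡⟨ rowSum-· B C (regular⇒rowSum≡ C K adjC regK) i ⟩
    rowSum B i * c    ≡⟨ cong (_* c) (regular⇒rowSum≡ B H adjB regH i) ⟩
    b * c             ∎
    where open ≡-Reasoning
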